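{- Let $2k+1$ be a prime. The class of finite simple graphs that admit a $(2k+1)$-neighborhood balanced coloring is not hereditary, i.e. it is not closed under taking induced subgraphs.
   Context: For a prime $2k+1$ (with $k\ge 1$), a $(2k+1)$-neighborhood balanced coloring of a finite simple graph is an assignment to each vertex of one of $2k+1$ colors $R_1,\dots,R_{2k+1}$ such that every vertex has an equal number of neighbors of each color. A family $\mathcal{F}$ of graphs is hereditary if $G\in\mathcal{F}$ and $H$ an induced subgraph of $G$ imply $H\in\mathcal{F}$. -}

module Defs where

open import Data.Nat using (ℕ; suc; _+_; _*_)
open import Data.Bool using (Bool; true; false)
open import Data.Fin using (Fin)
open import Data.List using (List; length; filter)
open import Data.List using () renaming (allFin to allFinL)
open import Data.Product using (Σ; ∃; _×_)
open import Function.Definitions using (Injective)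
open import Relation.Binary.PropositionalEquality using (_≡_)
open import Relation.Nullary using (¬_)
open import Data.Fin using (_≟_)
open import Relation.Nullary.Decidable using (⌊_⌋)
open import Data.Bool using (_∧_; T)
open import Level using (0ℓ)

record Graph : Set where
  field
    n    : ℕ
    adj  : Fin n → Fin n → Bool
    sym  : ∀ u v → adj u v ≡ adj v u
    irr  : ∀ v → adj v v ≡ false
open Graph public

InducedSubgraph : Graph → Graph → Set
InducedSubgraph H G =
  Σ (Fin (n H) → Fin (n G)) λ f →
    Injective _≡_ _≡_ f × (∀ u v → adj H u v ≡ adj G (f u) (f v))

Hereditary : (Graph → Set) → Set
Hereditary 𝓕 = ∀ G H → 𝓕 G → InducedSubgraph H G → 𝓕 H

nbrsOfColour : (G : Graph) {r : ℕ} → (Fin (n G) → Fin r) → Fin (n G) → Fin r → ℕ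
nbrsOfColour G c v i =
  length (filter (λ u → T? (adj G v u ∧ ⌊ c u ≟ i ⌋)) (allFinL (n G)))
  where
    open import Data.Bool.Properties using () renaming (T? to T?)

IsNbhdBalanced : (G : Graph) (r : ℕ) → (Fin (n G) → Fin r) → Set
IsNbhdBalanced G r c = ∀ v i j → nbrsOfColour G c v i ≡ nbrsOfColour G c v j

HasNbhdBalancedColouring : ℕ → Graph → Set
HasNbhdBalancedColouring r G = ∃ λ (c : Fin (n G) → Fin r) → IsNbhdBalanced G r c

-- Colour the complete bipartite graph K_{r,r} by giving the i-th vertex of each side colour i:
-- every vertex then has exactly one neighbour of each colour. Any edge of K_{r,r} induces a
-- copy of K₂, whose vertices have a single neighbour, so for r ≥ 2 some colour is seen once
-- and another not at all.
module Submission where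

open import Defs
open import Data.Nat using (ℕ; suc; _+_; _*_; _≤_; s≤s)
open import Data.Nat.Primality using (Prime)
open import Relation.Nullary using (¬_)

open import Data.Nat.Properties using (+-monoˡ-≤; *-monoʳ-≤; ≤-trans; n≤1+n)
  renaming (0≢1+n to ℕ-0≢1+n)
open import Data.Bool using (Bool; true; false; _∧_; T)
open import Data.Bool.Properties using (T?; T-∧; T-≡)
open import Data.Fin using (Fin; zero; suc; splitAt; join; _≟_; punchIn)
open import Data.Fin.Properties using (splitAt-join; join-splitAt; suc-injective; 0≢1+n; punchInᵢ≢i)
open import Data.List using (length; filter; tabulate)
open import Data.List.Properties using (filter-accept; filter-reject)
open import Data.Product using (_×_; _,_; proj₁; proj₂)
open import Data.Sum using (_⊎_; inj₁; inj₂)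
open import Data.Unit using (tt)
open import Data.Empty using (⊥-elim)
open import Function using (_∘_; id)
open import Function.Bundles using (Equivalence)
open import Relation.Nullary.Decidable using (⌊_⌋; toWitness; fromWitness)
open import Relation.Binary.PropositionalEquality
  using (_≡_; _≢_; refl; trans; cong) renaming (sym to ≡-sym)

length-filter-none : ∀ {A : Set} {m} (f : Fin m → A) (P : A → Bool) →
  (∀ u → ¬ T (P (f u))) → length (filter (T? ∘ P) (tabulate f)) ≡ 0
length-filter-none {m = 0}     f P none = refl
length-filter-none {m = suc m} f P none
  rewrite filter-reject (T? ∘ P) {xs = tabulate (f ∘ suc)} (none zero)
  = length-filter-none (f ∘ suc) P (none ∘ suc)

length-filter-unique : ∀ {A : Set} {m} (f : Fin m → A) (P : A → Bool) (w : Fin m) →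
  T (P (f w)) → (∀ u → T (P (f u)) → u ≡ w) → length (filter (T? ∘ P) (tabulate f)) ≡ 1
length-filter-unique f P zero Pw unique
  rewrite filter-accept (T? ∘ P) {xs = tabulate (f ∘ suc)} Pw
  = cong suc (length-filter-none (f ∘ suc) P λ u Pu → 0≢1+n (≡-sym (unique (suc u) Pu)))
length-filter-unique f P (suc w) Pw unique
  rewrite filter-reject (T? ∘ P) {xs = tabulate (f ∘ suc)} (0≢1+n ∘ unique zero)
  = length-filter-unique (f ∘ suc) P w Pw (λ u Pu → suc-injective (unique (suc u) Pu))

module _ (G : Graph) {r : ℕ} (c : Fin (n G) → Fin r) (v : Fin (n G)) (i : Fin r) where

  private
    isNbrOfColour : Fin (n G) → Bool
    isNbrOfColour u = adj G v u ∧ ⌊ c u ≟ i ⌋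

    isNbrOfColour⁺ : ∀ {u} → T (adj G v u) → c u ≡ i → T (isNbrOfColour u)
    isNbrOfColour⁺ vu cu = Equivalence.from T-∧ (vu , fromWitness cu)

    isNbrOfColour⁻ : ∀ {u} → T (isNbrOfColour u) → T (adj G v u) × c u ≡ i
    isNbrOfColour⁻ h with Equivalence.to T-∧ h
    ... | vu , cu = vu , toWitness cu

  nbrsOfColour≡0 : (∀ u → T (adj G v u) → c u ≢ i) → nbrsOfColour G c v i ≡ 0
  nbrsOfColour≡0 none = length-filter-none id isNbrOfColour
    λ u h → none u (proj₁ (isNbrOfColour⁻ h)) (proj₂ (isNbrOfColour⁻ h))

  nbrsOfColour≡1 : (w : Fin (n G)) → T (adj G v w) → c w ≡ i →
    (∀ u → T (adj G v u) → c u ≡ i → u ≡ w) → nbrsOfColour G c v i ≡ 1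
  nbrsOfColour≡1 w vw cw unique = length-filter-unique id isNbrOfColour w
    (isNbrOfColour⁺ vw cw) λ u h → unique u (proj₁ (isNbrOfColour⁻ h)) (proj₂ (isNbrOfColour⁻ h))

module _ (r : ℕ) where

  private
    Side : Set
    Side = Fin r ⊎ Fin r

    crosses : Side → Side → Bool
    crosses (inj₁ _) (inj₂ _) = true
    crosses (inj₂ _) (inj₁ _) = true
    crosses _        _        = false

    crosses-sym : ∀ a b → crosses a b ≡ crosses b a
    crosses-sym (inj₁ _) (inj₁ _) = refl
    crosses-sym (inj₁ _) (inj₂ _) = refl
    crosses-sym (inj₂ _) (inj₁ _) = refl
    crosses-sym (inj₂ _) (inj₂ _) = refl

    crosses-irr : ∀ a → crosses a a ≡ false
    crosses-irr (inj₁ _) = refl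
    crosses-irr (inj₂ _) = refl

    index : Side → Fin r
    index (inj₁ x) = x
    index (inj₂ x) = x

    across : Side → Fin r → Side
    across (inj₁ _) i = inj₂ i
    across (inj₂ _) i = inj₁ i

    crosses-across : ∀ a i → T (crosses a (across a i))
    crosses-across (inj₁ _) i = tt
    crosses-across (inj₂ _) i = tt

    across-unique : ∀ a b i → T (crosses a b) → index b ≡ i → b ≡ across a i
    across-unique (inj₁ _) (inj₂ _) i _ refl = refl
    across-unique (inj₂ _) (inj₁ _) i _ refl = refl

  completeBipartite : Graph
  completeBipartite = record
    { n   = r + r
    ; adj = λ u v → crosses (splitAt r u) (splitAt r v)
    ; sym = λ u v → crosses-sym (splitAt r u) (splitAt r v)
    ; irr = λ v → crosses-irr (splitAt r v)
    }

  sideIndexColouring : Fin (r + r) → Fin r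
  sideIndexColouring = index ∘ splitAt r

  opposite : Fin (r + r) → Fin r → Fin (r + r)
  opposite v i = join r r (across (splitAt r v) i)

  adj-opposite : ∀ v i → T (adj completeBipartite v (opposite v i))
  adj-opposite v i rewrite splitAt-join r r (across (splitAt r v) i) =
    crosses-across (splitAt r v) i

  sideIndexColouring-opposite : ∀ v i → sideIndexColouring (opposite v i) ≡ i
  sideIndexColouring-opposite v i rewrite splitAt-join r r (across (splitAt r v) i) with splitAt r v
  ... | inj₁ _ = refl
  ... | inj₂ _ = refl

  opposite-unique : ∀ v i u → T (adj completeBipartite v u) → sideIndexColouring u ≡ i →
    u ≡ opposite v i
  opposite-unique v i u vu cu = trans (≡-sym (join-splitAt r r u))
    (cong (join r r) (across-unique (splitAt r v) (splitAt r u) i vu cu))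

  sideIndexColouring-balanced : IsNbhdBalanced completeBipartite r sideIndexColouring
  sideIndexColouring-balanced v i j = trans (exactlyOne i) (≡-sym (exactlyOne j))
    where
    exactlyOne : ∀ i → nbrsOfColour completeBipartite sideIndexColouring v i ≡ 1
    exactlyOne i = nbrsOfColour≡1 completeBipartite sideIndexColouring v i (opposite v i)
      (adj-opposite v i) (sideIndexColouring-opposite v i) (opposite-unique v i)

adjK₂ : Fin 2 → Fin 2 → Bool
adjK₂ zero       (suc zero) = true
adjK₂ (suc zero) zero       = true
adjK₂ _          _          = false

K₂ : Graph
K₂ = record { n = 2 ; adj = adjK₂ ; sym = adjK₂-sym ; irr = adjK₂-irr }
  where
  adjK₂-sym : ∀ u v → adjK₂ u v ≡ adjK₂ v u
  adjK₂-sym zero       zero       = refl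
  adjK₂-sym zero       (suc zero) = refl
  adjK₂-sym (suc zero) zero       = refl
  adjK₂-sym (suc zero) (suc zero) = refl

  adjK₂-irr : ∀ v → adjK₂ v v ≡ false
  adjK₂-irr zero       = refl
  adjK₂-irr (suc zero) = refl

edge⇒K₂-induced : ∀ G {u v} → T (adj G u v) → InducedSubgraph K₂ G
edge⇒K₂-induced G {u} {v} uv = f , f-injective , f-adj
  where
  uv≡true : adj G u v ≡ true
  uv≡true = Equivalence.to T-≡ uv

  f : Fin 2 → Fin (n G)
  f zero       = u
  f (suc zero) = v

  u≢v : u ≢ v
  u≢v refl with trans (≡-sym uv≡true) (irr G u)
  ... | ()

  f-injective : ∀ {a b} → f a ≡ f b → a ≡ b
  f-injective {zero}     {zero}     _   = refl
  f-injective {zero}     {suc zero} u≡v = ⊥-elim (u≢v u≡v)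
  f-injective {suc zero} {zero}     v≡u = ⊥-elim (u≢v (≡-sym v≡u))
  f-injective {suc zero} {suc zero} _   = refl

  f-adj : ∀ a b → adjK₂ a b ≡ adj G (f a) (f b)
  f-adj zero       zero       = ≡-sym (irr G u)
  f-adj zero       (suc zero) = ≡-sym uv≡true
  f-adj (suc zero) zero       = ≡-sym (trans (Graph.sym G v u) uv≡true)
  f-adj (suc zero) (suc zero) = ≡-sym (irr G v)

uniqueNeighbour⇒¬balanced : ∀ G {r} → 2 ≤ r → (v w : Fin (n G)) → T (adj G v w) →
  (∀ u → T (adj G v u) → u ≡ w) → ¬ HasNbhdBalancedColouring r G
uniqueNeighbour⇒¬balanced G {r} (s≤s (s≤s _)) v w vw unique (c , balanced) =
  ℕ-0≢1+n (trans (≡-sym seenNever) (trans (balanced v other (c w)) seenOnce))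
  where
  other : Fin r
  other = punchIn (c w) zero

  seenOnce : nbrsOfColour G c v (c w) ≡ 1
  seenOnce = nbrsOfColour≡1 G c v (c w) w vw refl (λ u vu _ → unique u vu)

  seenNever : nbrsOfColour G c v other ≡ 0
  seenNever = nbrsOfColour≡0 G c v other λ u vu cu →
    punchInᵢ≢i (c w) zero (trans (≡-sym cu) (cong c (unique u vu)))

nbhdBalanced-¬hereditary : ∀ {r} → 2 ≤ r → ¬ Hereditary (HasNbhdBalancedColouring r)
nbhdBalanced-¬hereditary {r@(suc _)} 2≤r hereditary =
  uniqueNeighbour⇒¬balanced K₂ 2≤r zero (suc zero) tt K₂-unique
    (hereditary (completeBipartite r) K₂
      (sideIndexColouring r , sideIndexColouring-balanced r)
      (edge⇒K₂-induced (completeBipartite r) {zero} (adj-opposite r zero zero)))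
  where
  K₂-unique : ∀ u → T (adjK₂ zero u) → u ≡ suc zero
  K₂-unique (suc zero) _ = refl

corollary2p17 : (k : ℕ) → 1 ≤ k → Prime (2 * k + 1) →
    ¬ Hereditary (HasNbhdBalancedColouring (2 * k + 1))
corollary2p17 k 1≤k _ = nbhdBalanced-¬hereditary (≤-trans (n≤1+n 2) (+-monoˡ-≤ 1 (*-monoʳ-≤ 2 1≤k)))
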